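{- Let $G$ be a graph in which all the weights $W$ below are well defined (e.g. $\delta(G)>\frac34 v(G)$). If $O=(x_1,x_2,x_3) \in \mathcal{OK}_3(G)$ and $R=\bigcap_{i=1}^3 N(x_i)$, then \begin{align*} w_G(O) = &\frac{1}{6} \Bigg( W(x_1,x_2) -\sum_{y\in R} \Bigg( W(x_1,y,x_2) - W(x_1,x_2,y) \\ &+ \sum_{z\in N(y)\cap R}\Big( W(x_1,y,x_2,z) - W(x_1,x_2,y,z) + W(x_1,y,z,x_2) - W(z,y,x_1,x_2)\Big) \Bigg) \Bigg). \end{align*}
   Context: $N(v)$ is the neighbourhood of $v$. $\mathcal{K}_\ell(G,S)$ is the set of $\ell$-cliques of $G$ containing the vertex set $S$. An ordered $r$-clique is a tuple $(v_1,\ldots,v_r)$ of distinct vertices spanning a clique; $\mathcal{OK}_r(G)$ is the set of these. For $(v_1,\ldots,v_r)\in\mathcal{OK}_r(G)$, $r\in\{2,3,4\}$, $W(v_1,\ldots,v_r)=\prod_{i=2}^r \frac{1}{|\mathcal{K}_{i+1}(G,\{v_1,\ldots,v_i\})|}$. For $O=(x_1,x_2,x_3)\in\mathcal{OK}_3(G)$, $\mathcal{OK}_5(G,O)$ is the set of $(v_1,\ldots,v_5)\in\mathcal{OK}_5(G)$ in which $x_1,x_2,x_3$ appears as a (not necessarily consecutive) subsequence; for such $K$, $\psi_K(O)=+\frac13$ if $|\{x_1,x_2,x_3\}\cap\{v_1,v_2\}|\in\{0,2\}$ and $-\frac16$ if it equals $1$. Define $w_G(O)=\frac12\sum_{K=(v_1,\ldots,v_5)\in\mathcal{OK}_5(G,O)}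 W(v_1,\ldots,v_4)\,\psi_K(O)$. -}

module Defs where

open import Data.Bool using (Bool; true; false; _∧_; _∨_; if_then_else_; not)
open import Data.Nat using (ℕ; zero; suc; _+_; _∸_; _≡ᵇ_)
open import Data.Integer using (+_)
open import Data.Fin using (Fin; zero; suc)
open import Data.Fin.Properties using (_≟_)
open import Data.Vec using (Vec; []; _∷_; lookup)
open import Data.Fin.Subset using (Subset; ∣_∣)
open import Data.List using (List; []; _∷_; map; concatMap; allFin; filterᵇ; length; foldr; take; upTo)
open import Data.Rational using (ℚ; _/_; 0ℚ; 1ℚ; -_) renaming (_*_ to _*ℚ_; _+_ to _+ℚ_; _-_ to _-ℚ_)
open import Relation.Nullary using (does)
open import Relation.Binary.PropositionalEquality using (_≡_)

record Graph : Set where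
  field
    n     : ℕ
    adj   : Fin n → Fin n → Bool
    sym   : ∀ u v → adj u v ≡ adj v u
    irref : ∀ v → adj v v ≡ false

module _ (G : Graph) where
  open Graph G

  V : Set
  V = Fin n

  eqV : V → V → Bool
  eqV u v = does (u ≟ v)

  -- a list of vertices is (the vertex sequence of) an ordered clique:
  -- pairwise adjacent (hence, by irreflexivity, pairwise distinct)
  allᵇ : (V → Bool) → List V → Bool
  allᵇ p [] = true
  allᵇ p (x ∷ xs) = p x ∧ allᵇ p xs

  isClique : List V → Bool
  isClique [] = true
  isClique (x ∷ xs) = allᵇ (adj x) xs ∧ isClique xs

  allSubsets : (k : ℕ) → List (Subset k)
  allSubsets zero = [] ∷ []
  allSubsets (suc k) = concatMap (λ b → map (b ∷_) (allSubsets k)) (true ∷ false ∷ [])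

  elems : ∀ {k} → Subset k → List (Fin k)
  elems [] = []
  elems (true ∷ s) = zero ∷ map suc (elems s)
  elems (false ∷ s) = map suc (elems s)

  -- |K_ℓ(G,S)| : number of ℓ-cliques (as vertex sets) of G containing all vertices of S
  cntK : ℕ → List V → ℕ
  cntK ℓ S = length (filterᵇ
    (λ T → (∣ T ∣ ≡ᵇ ℓ) ∧ isClique (elems T) ∧ allᵇ (lookup T) S)
    (allSubsets n))

  -- 1/k, with the (irrelevant, see hypothesis WellDefined) convention 1/0 = 0
  inv : ℕ → ℚ
  inv zero = 0ℚ
  inv (suc k) = + 1 / suc k

  prodℚ : List ℚ → ℚ
  prodℚ = foldr _*ℚ_ 1ℚ

  sumℚ : List ℚ → ℚ
  sumℚ = foldr _+ℚ_ 0ℚ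

  -- W(v_1,…,v_r) = ∏_{i=2}^r 1 / |K_{i+1}(G,{v_1,…,v_i})|
  W : List V → ℚ
  W vs = prodℚ (map (λ k → inv (cntK (k + 3) (take (k + 2) vs))) (upTo (length vs ∸ 1)))

  -- all weights W are well defined: every denominator occurring in W on
  -- ordered r-cliques, r ∈ {2,3,4}, is nonzero; i.e. every ordered i-clique,
  -- i ∈ {2,3,4}, lies in at least one (i+1)-clique.
  WellDefined : Set
  WellDefined = ∀ (t : List V) → isClique t ≡ true →
    (length t ≡ 2 ⊎' length t ≡ 3 ⊎' length t ≡ 4) → ¬' (cntK (suc (length t)) t ≡ 0)
    where
      open import Data.Sum using () renaming (_⊎_ to _⊎'_)
      open import Relation.Nullary using () renaming (¬_ to ¬'_)

  tuples : ℕ → List (List V)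
  tuples zero = [] ∷ []
  tuples (suc k) = concatMap (λ v → map (v ∷_) (tuples k)) (allFin n)

  isSubseq : List V → List V → Bool
  isSubseq [] ys = true
  isSubseq (x ∷ xs) [] = false
  isSubseq (x ∷ xs) (y ∷ ys) = if eqV x y then isSubseq xs ys else isSubseq (x ∷ xs) ys

  OK5 : V → V → V → List (List V)
  OK5 x₁ x₂ x₃ = filterᵇ (λ t → isClique t ∧ isSubseq (x₁ ∷ x₂ ∷ x₃ ∷ []) t) (tuples 5)

  memO : V → V → V → V → Bool
  memO x₁ x₂ x₃ v = eqV v x₁ ∨ eqV v x₂ ∨ eqV v x₃

  -- |{x₁,x₂,x₃} ∩ {v₁,v₂}| (v₁ ≠ v₂ for ordered cliques)
  interSize : V → V → V → List V → ℕ
  interSize x₁ x₂ x₃ (v₁ ∷ v₂ ∷ _) =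
    (if memO x₁ x₂ x₃ v₁ then 1 else 0) + (if memO x₁ x₂ x₃ v₂ then 1 else 0)
  interSize x₁ x₂ x₃ _ = 0

  ψ : V → V → V → List V → ℚ
  ψ x₁ x₂ x₃ K with interSize x₁ x₂ x₃ K
  ... | 1 = - (+ 1 / 6)
  ... | _ = + 1 / 3

  w : V → V → V → ℚ
  w x₁ x₂ x₃ = (+ 1 / 2) *ℚ sumℚ (map (λ K → W (take 4 K) *ℚ ψ x₁ x₂ x₃ K) (OK5 x₁ x₂ x₃))

  inR : V → V → V → V → Bool
  inR x₁ x₂ x₃ y = adj x₁ y ∧ adj x₂ y ∧ adj x₃ y

  R : V → V → V → List V
  R x₁ x₂ x₃ = filterᵇ (inR x₁ x₂ x₃) (allFin n)

  NR : V → V → V → V → List V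
  NR x₁ x₂ x₃ y = filterᵇ (λ z → adj y z ∧ inR x₁ x₂ x₃ z) (allFin n)

  rhs : V → V → V → ℚ
  rhs x₁ x₂ x₃ = (+ 1 / 6) *ℚ (W (x₁ ∷ x₂ ∷ []) -ℚ sumℚ (map (λ y →
      W (x₁ ∷ y ∷ x₂ ∷ []) -ℚ W (x₁ ∷ x₂ ∷ y ∷ [])
      +ℚ sumℚ (map (λ z →
          W (x₁ ∷ y ∷ x₂ ∷ z ∷ []) -ℚ W (x₁ ∷ x₂ ∷ y ∷ z ∷ [])
          +ℚ W (x₁ ∷ y ∷ z ∷ x₂ ∷ []) -ℚ W (z ∷ y ∷ x₁ ∷ x₂ ∷ []))
        (NR x₁ x₂ x₃ y)))
    (R x₁ x₂ x₃)))

-- Since a clique has no repeated vertex, every K ∈ OK₅(G,O) arises in exactly one way by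
-- inserting two further vertices y, z into the sequence x₁ x₂ x₃, so w_G(O) splits into ten
-- sums, one for each placement of y and z, and on each of them ψ_K(O) is constant. When the
-- fifth vertex is free, summing W(v₁,…,v₄) over it gives W(v₁,v₂,v₃): the common neighbours
-- of the 4-clique {v₁,…,v₄} are counted by |K₅(G,{v₁,…,v₄})|, the denominator of the last
-- factor of W. For the placement x₁x₂x₃yz the same happens once more one level down. What
-- remains are sums over y ∈ R and z ∈ N(y) ∩ R of weights W, which are symmetric in their
-- first two arguments, and collecting the coefficients 1/3 and -1/6 gives the formula.

module Submission where

open import Defs
open import Data.List using (List; []; _∷_)
open import Relation.Binary.PropositionalEquality using (_≡_)
open import Data.Bool using (true)

open import Algebra.Bundles using (CommutativeRing)
open import Data.Bool using (Bool; false; _∧_; _∨_; not; if_then_else_; T)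
open import Data.Bool.Properties using (∧-comm; ∧-assoc; ∧-zeroʳ; ∧-identityʳ; ∨-zeroʳ; ⇔→≡; ¬-not; T?)
open import Data.Fin using (Fin; zero; suc)
open import Data.Fin.Properties using (_≟_; suc-injective)
open import Data.Fin.Subset using (Subset; ∣_∣; ⊥)
open import Data.Fin.Subset.Properties using (∣⊥∣≡0)
open import Data.Integer using (+_)
import Data.Integer as ℤ
import Data.Integer.Properties as ℤ
open import Data.List using (map; foldr; filterᵇ; length; allFin; tabulate; concatMap; _++_; take; upTo)
open import Data.List.Properties using (map-tabulate; map-∘; map-cong; length-++; filter-++; filter-≐)
open import Data.List.Membership.Propositional using (_∈_)
open import Data.List.Membership.Propositional.Properties using (∈-map⁺; ∈-map⁻)
open import Data.List.Relation.Binary.Permutation.Propositional as ↭ using (_↭_)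
open import Data.List.Relation.Binary.Permutation.Propositional.Properties using (shift)
open import Data.List.Relation.Unary.All as All using (All; []; _∷_)
open import Data.List.Relation.Unary.AllPairs using ([]; _∷_)
open import Data.List.Relation.Unary.Any using (here; there)
open import Data.List.Relation.Unary.Unique.Propositional using (Unique)
import Data.List.Relation.Unary.Unique.Propositional.Properties as Unique
open import Data.Nat as ℕ using (ℕ; zero; suc; _≤_; _<_; z≤n; s≤s; _≡ᵇ_)
import Data.Nat.Properties as ℕ
open import Data.Product using (_×_; _,_; proj₂)
open import Data.Rational using (ℚ; 0ℚ; 1ℚ; _/_; _+_; _*_; _-_; -_; toℚᵘ)
open import Data.Rational.Properties
  using (+-identityˡ; +-identityʳ; +-assoc; *-assoc; *-comm; *-zeroʳ; *-identityʳ; *-distribˡ-+; neg-distrib-+;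
         toℚᵘ-injective; toℚᵘ-homo-*; toℚᵘ-homo-+; toℚᵘ-fromℚᵘ; +-*-commutativeRing)
import Data.Rational.Properties as ℚ
import Data.Rational.Unnormalised as ℚᵘ
import Data.Rational.Unnormalised.Properties as ℚᵘ
open import Data.Sum using (_⊎_; inj₁; inj₂)
open import Data.Vec using ([]; _∷_; lookup; _[_]≔_)
open import Data.Vec.Properties using (lookup∘update; lookup∘update′; lookup-replicate)
open import Function using (_∘_; mk⇔)
open import Relation.Binary.PropositionalEquality using (refl; sym; trans; cong; cong₂; subst; _≢_; _≗_; module ≡-Reasoning)
open import Relation.Nullary using (does; yes; no; contradiction)
open import Relation.Nullary.Decidable using (dec⇒maybe)
open import Algebra.Properties.Semiring.Sum (CommutativeRing.semiring +-*-commutativeRing)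
  using (sum; ∑-distrib-+; *-distribˡ-sum; sum-cong-≗; sum-replicate-zero)
open import Tactic.RingSolver using (solve-∀)
open import Tactic.RingSolver.Core.AlmostCommutativeRing using (AlmostCommutativeRing; fromCommutativeRing)

when : Bool → ℚ → ℚ
when b x = if b then x else 0ℚ

fromℕ : ℕ → ℚ
fromℕ m = + m / 1

fromℕ-suc : ∀ m → fromℕ (suc m) ≡ 1ℚ + fromℕ m
fromℕ-suc m = toℚᵘ-injective (begin
  toℚᵘ (fromℕ (suc m))                ≈⟨ toℚᵘ-fromℚᵘ (ℚᵘ.mkℚᵘ (+ suc m) 0) ⟩
  ℚᵘ.mkℚᵘ (+ suc m) 0                 ≈⟨ ℚᵘ.*≡* (trans (ℤ.*-identityʳ (+ suc m)) (sym (trans (ℤ.*-identityʳ _)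
                                          (cong₂ ℤ._+_ (ℤ.*-identityʳ (+ 1)) (ℤ.*-identityʳ (+ m)))))) ⟩
  ℚᵘ.1ℚᵘ ℚᵘ.+ ℚᵘ.mkℚᵘ (+ m) 0          ≈⟨ ℚᵘ.+-congʳ ℚᵘ.1ℚᵘ (toℚᵘ-fromℚᵘ (ℚᵘ.mkℚᵘ (+ m) 0)) ⟨
  toℚᵘ 1ℚ ℚᵘ.+ toℚᵘ (fromℕ m)          ≈⟨ toℚᵘ-homo-+ 1ℚ (fromℕ m) ⟨
  toℚᵘ (1ℚ + fromℕ m)                 ∎)
  where open ℚᵘ.≃-Reasoning

1/n*n≡1 : ∀ k → (+ 1 / suc k) * fromℕ (suc k) ≡ 1ℚ
1/n*n≡1 k = toℚᵘ-injective (ℚᵘ.≃-trans (toℚᵘ-homo-* (+ 1 / suc k) (fromℕ (suc k)))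
  (ℚᵘ.≃-trans (ℚᵘ.*-cong (toℚᵘ-fromℚᵘ (ℚᵘ.mkℚᵘ (+ 1) k)) (toℚᵘ-fromℚᵘ (ℚᵘ.mkℚᵘ (+ suc k) 0)))
    (ℚᵘ.*-inverseˡ (ℚᵘ.mkℚᵘ (+ suc k) 0))))

*-rotate : ∀ x i k → (x * i) * k ≡ (k * x) * i
*-rotate x i k = trans (*-assoc x i k) (trans (cong (x *_) (*-comm i k)) (trans (sym (*-assoc x k i)) (cong (_* i) (*-comm x k))))

when-cong : ∀ b {x y} → (b ≡ true → x ≡ y) → when b x ≡ when b y
when-cong true  x≡y = x≡y refl
when-cong false _   = refl

when-∧ : ∀ a b x → when (a ∧ b) x ≡ when a (when b x)
when-∧ true  b x = refl
when-∧ false b x = refl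

when-∧-swap : ∀ a b x → when (a ∧ b) x ≡ when b (when a x)
when-∧-swap true  b x = refl
when-∧-swap false true  x = refl
when-∧-swap false false x = refl

sumMap : {A : Set} → (A → ℚ) → List A → ℚ
sumMap f xs = foldr _+_ 0ℚ (map f xs)

module _ {A : Set} where

  sumMap-cong : ∀ {f g : A → ℚ} → f ≗ g → ∀ xs → sumMap f xs ≡ sumMap g xs
  sumMap-cong f≗g xs = cong (foldr _+_ 0ℚ) (map-cong f≗g xs)

  sumMap-zero : ∀ (xs : List A) → sumMap (λ _ → 0ℚ) xs ≡ 0ℚ
  sumMap-zero []       = refl
  sumMap-zero (x ∷ xs) = trans (+-identityˡ _) (sumMap-zero xs)

  sumMap-++ : ∀ (f : A → ℚ) xs ys → sumMap f (xs ++ ys) ≡ sumMap f xs + sumMap f ys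
  sumMap-++ f []       ys = sym (+-identityˡ _)
  sumMap-++ f (x ∷ xs) ys = trans (cong (_+_ (f x)) (sumMap-++ f xs ys)) (sym (+-assoc (f x) _ _))

  sumMap-filterᵇ : ∀ p (f : A → ℚ) xs → sumMap f (filterᵇ p xs) ≡ sumMap (λ x → when (p x) (f x)) xs
  sumMap-filterᵇ p f []       = refl
  sumMap-filterᵇ p f (x ∷ xs) with p x
  ... | true  = cong (_+_ (f x)) (sumMap-filterᵇ p f xs)
  ... | false = trans (sumMap-filterᵇ p f xs) (sym (+-identityˡ _))

  sumMap-count : ∀ (p : A → Bool) c xs → sumMap (λ x → when (p x) c) xs ≡ c * fromℕ (length (filterᵇ p xs))
  sumMap-count p c []       = sym (*-zeroʳ c)
  sumMap-count p c (x ∷ xs) with p x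
  ... | true  = begin
    c + sumMap (λ x → when (p x) c) xs   ≡⟨ cong (_+_ c) (sumMap-count p c xs) ⟩
    c + c * fromℕ m                      ≡⟨ cong (_+ c * fromℕ m) (*-identityʳ c) ⟨
    c * 1ℚ + c * fromℕ m                 ≡⟨ *-distribˡ-+ c 1ℚ (fromℕ m) ⟨
    c * (1ℚ + fromℕ m)                   ≡⟨ cong (c *_) (fromℕ-suc m) ⟨
    c * fromℕ (suc m)                    ∎
    where open ≡-Reasoning
          m = length (filterᵇ p xs)
  ... | false = trans (+-identityˡ _) (sumMap-count p c xs)

  module _ {B : Set} where

    sumMap-map : ∀ (f : A → ℚ) (g : B → A) xs → sumMap f (map g xs) ≡ sumMap (f ∘ g) xs
    sumMap-map f g xs = cong (foldr _+_ 0ℚ) (sym (map-∘ xs))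

    sumMap-concatMap : ∀ (f : A → ℚ) (g : B → List A) xs → sumMap f (concatMap g xs) ≡ sumMap (sumMap f ∘ g) xs
    sumMap-concatMap f g []       = refl
    sumMap-concatMap f g (x ∷ xs) = trans (sumMap-++ f (g x) _) (cong (_+_ (sumMap f (g x))) (sumMap-concatMap f g xs))

sumMap-when-if : ∀ {A : Set} b (p q : A → Bool) (H : A → ℚ) xs →
  sumMap (λ t → when (if b then p t else q t) (H t)) xs
    ≡ (if b then sumMap (λ t → when (p t) (H t)) xs else sumMap (λ t → when (q t) (H t)) xs)
sumMap-when-if true  p q H xs = refl
sumMap-when-if false p q H xs = refl

foldr-tabulate : ∀ {n} (g : Fin n → ℚ) → foldr _+_ 0ℚ (tabulate g) ≡ sum g
foldr-tabulate {zero}  g = refl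
foldr-tabulate {suc n} g = cong (_+_ (g zero)) (foldr-tabulate (g ∘ suc))

sum-neg : ∀ {n} (f : Fin n → ℚ) → sum (λ v → - f v) ≡ - sum f
sum-neg {zero}  f = refl
sum-neg {suc n} f = trans (cong (_+_ (- f zero)) (sum-neg (f ∘ suc))) (sym (neg-distrib-+ (f zero) _))

sum-δ : ∀ {n} (x : Fin n) (f : Fin n → ℚ) → sum (λ v → when (does (x ≟ v)) (f v)) ≡ f x
sum-δ {suc n} zero f = trans (cong (_+_ (f zero)) (sum-replicate-zero n)) (+-identityʳ (f zero))
sum-δ (suc x)       f = trans (+-identityˡ _) (sum-δ x (f ∘ suc))

module _ {n : ℕ} where

  sumMap-allFin : ∀ (f : Fin n → ℚ) → sumMap f (allFin n) ≡ sum f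
  sumMap-allFin f = trans (cong (foldr _+_ 0ℚ) (map-tabulate (λ v → v) f)) (foldr-tabulate f)

  sumOn : (Fin n → Bool) → (Fin n → ℚ) → ℚ
  sumOn p f = sum (λ v → when (p v) (f v))

  sumMap-filterᵇ-allFin : ∀ p f → sumMap f (filterᵇ p (allFin n)) ≡ sumOn p f
  sumMap-filterᵇ-allFin p f = trans (sumMap-filterᵇ p f (allFin n)) (sumMap-allFin _)

  sum-zero : sum {n} (λ _ → 0ℚ) ≡ 0ℚ
  sum-zero = sum-replicate-zero n

  sum-when : ∀ b (f : Fin n → ℚ) → sum (λ v → when b (f v)) ≡ when b (sum f)
  sum-when true  f = refl
  sum-when false f = sum-zero

  sum-if-≟ : ∀ x (f g : Fin n → ℚ) → g x ≡ 0ℚ →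
    sum (λ v → if does (x ≟ v) then f v else g v) ≡ f x + sum g
  sum-if-≟ x f g gx≡0 = begin
    sum (λ v → if does (x ≟ v) then f v else g v)    ≡⟨ sum-cong-≗ split ⟩
    sum (λ v → when (does (x ≟ v)) (f v) + g v)      ≡⟨ ∑-distrib-+ _ g ⟩
    sum (λ v → when (does (x ≟ v)) (f v)) + sum g    ≡⟨ cong (_+ sum g) (sum-δ x f) ⟩
    f x + sum g                                      ∎
    where
      open ≡-Reasoning
      split : ∀ v → (if does (x ≟ v) then f v else g v) ≡ when (does (x ≟ v)) (f v) + g v
      split v with x ≟ v
      ... | yes refl = trans (sym (+-identityʳ (f x))) (cong (_+_ (f x)) (sym gx≡0))
      ... | no  _    = sym (+-identityˡ (g v))

  sumOn-cong : ∀ p {f g : Fin n → ℚ} → (∀ v → p v ≡ true → f v ≡ g v) → sumOn p f ≡ sumOn p g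
  sumOn-cong p f≗g = sum-cong-≗ pointwise
    where
      pointwise : ∀ v → when (p v) _ ≡ when (p v) _
      pointwise v with p v in eq
      ... | true  = f≗g v eq
      ... | false = refl

  sumOn-+ : ∀ p (f g : Fin n → ℚ) → sumOn p (λ v → f v + g v) ≡ sumOn p f + sumOn p g
  sumOn-+ p f g = trans (sum-cong-≗ pointwise) (∑-distrib-+ (λ v → when (p v) (f v)) (λ v → when (p v) (g v)))
    where
      pointwise : ∀ v → when (p v) (f v + g v) ≡ when (p v) (f v) + when (p v) (g v)
      pointwise v with p v
      ... | true  = refl
      ... | false = refl

  sumOn-- : ∀ p (f g : Fin n → ℚ) → sumOn p (λ v → f v - g v) ≡ sumOn p f - sumOn p g
  sumOn-- p f g = trans (sum-cong-≗ pointwise)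
    (trans (∑-distrib-+ (λ v → when (p v) (f v)) (λ v → - when (p v) (g v))) (cong (_+_ (sumOn p f)) (sum-neg (λ v → when (p v) (g v)))))
    where
      pointwise : ∀ v → when (p v) (f v - g v) ≡ when (p v) (f v) - when (p v) (g v)
      pointwise v with p v
      ... | true  = refl
      ... | false = refl

  sumOn-*ˡ : ∀ p c (f : Fin n → ℚ) → sumOn p (λ v → c * f v) ≡ c * sumOn p f
  sumOn-*ˡ p c f = trans (sum-cong-≗ pointwise) (sym (*-distribˡ-sum c (λ v → when (p v) (f v))))
    where
      pointwise : ∀ v → when (p v) (c * f v) ≡ c * when (p v) (f v)
      pointwise v with p v
      ... | true  = refl
      ... | false = sym (*-zeroʳ c)

  sumOn-const : ∀ p c → sumOn p (λ _ → c) ≡ c * fromℕ (length (filterᵇ p (allFin n)))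
  sumOn-const p c = trans (sym (sumMap-allFin _)) (sumMap-count p c (allFin n))

  sumOn-combination : ∀ (p : Fin n → Bool) (f g h k : Fin n → ℚ) →
    sumOn p (λ v → ((f v - g v) + h v) - k v) ≡ ((sumOn p f - sumOn p g) + sumOn p h) - sumOn p k
  sumOn-combination p f g h k =
    trans (sumOn-- p (λ v → (f v - g v) + h v) k)
      (cong (_- sumOn p k) (trans (sumOn-+ p (λ v → f v - g v) h) (cong (_+ sumOn p h) (sumOn-- p f g))))

sum-+ : ∀ {n} {f g : Fin n → ℚ} {a b} → sum f ≡ a → sum g ≡ b → sum (λ v → f v + g v) ≡ a + b
sum-+ {f = f} {g} Σf≡a Σg≡b = trans (∑-distrib-+ f g) (cong₂ _+_ Σf≡a Σg≡b)

∧-swapˡ : ∀ a b c → a ∧ (b ∧ c) ≡ b ∧ (a ∧ c)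
∧-swapˡ a b c = trans (sym (∧-assoc a b c)) (trans (cong (_∧ c) (∧-comm a b)) (∧-assoc b a c))

∧-interchange : ∀ e a b c → (e ∧ a) ∧ (b ∧ c) ≡ (e ∧ b) ∧ (a ∧ c)
∧-interchange false a b c = refl
∧-interchange true  a b c = ∧-swapˡ a b c

∧-true⁻ : ∀ a {b} → a ∧ b ≡ true → a ≡ true × b ≡ true
∧-true⁻ true b≡true = refl , b≡true

∧-true⁺ : ∀ {a b} → a ≡ true → b ≡ true → a ∧ b ≡ true
∧-true⁺ refl refl = refl

not≡true⁻ : ∀ {a} → not a ≡ true → a ≡ false
not≡true⁻ {false} _ = refl

∧∧false : ∀ a b → a ∧ b ∧ false ≡ false
∧∧false a b = trans (cong (a ∧_) (∧-zeroʳ b)) (∧-zeroʳ a)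

filterᵇ-cong : ∀ {A : Set} {p q : A → Bool} → p ≗ q → filterᵇ p ≗ filterᵇ q
filterᵇ-cong {p = p} {q} p≗q = filter-≐ (T? ∘ p) (T? ∘ q) ((λ {x} → subst T (p≗q x)) , (λ {x} → subst T (sym (p≗q x))))

count : {A : Set} → (A → Bool) → List A → ℕ
count p xs = length (filterᵇ p xs)

module _ {A : Set} where

  count-∷ : ∀ (p : A → Bool) x xs → count p (x ∷ xs) ≡ (if p x then 1 else 0) ℕ.+ count p xs
  count-∷ p x xs with p x
  ... | true  = refl
  ... | false = refl

  count-++ : ∀ (p : A → Bool) xs ys → count p (xs ++ ys) ≡ count p xs ℕ.+ count p ys
  count-++ p xs ys = trans (cong length (filter-++ _ xs ys)) (length-++ (filterᵇ p xs))

  count-cong : ∀ {p q : A → Bool} → p ≗ q → ∀ xs → count p xs ≡ count q xs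
  count-cong p≗q xs = cong length (filterᵇ-cong p≗q xs)

  count-false : ∀ (xs : List A) → count (λ _ → false) xs ≡ 0
  count-false []       = refl
  count-false (x ∷ xs) = count-false xs

count-map : ∀ {A B : Set} (p : A → Bool) (f : B → A) xs → count p (map f xs) ≡ count (p ∘ f) xs
count-map p f []       = refl
count-map p f (x ∷ xs) = trans (count-∷ p (f x) _) (trans (cong (_ ℕ.+_) (count-map p f xs)) (sym (count-∷ (p ∘ f) x xs)))

count-allFin-suc : ∀ k (q : Fin (suc k) → Bool) →
  count q (allFin (suc k)) ≡ (if q zero then 1 else 0) ℕ.+ count (q ∘ suc) (allFin k)
count-allFin-suc k q = trans (count-∷ q zero _)
  (cong ((if q zero then 1 else 0) ℕ.+_) (trans (cong (count q) (sym (map-tabulate (λ v → v) suc))) (count-map q suc (allFin k))))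

_⊆ᵇ_ : ∀ {k} → Subset k → Subset k → Bool
[]      ⊆ᵇ []      = true
(a ∷ s) ⊆ᵇ (b ∷ t) = (not a ∨ b) ∧ (s ⊆ᵇ t)

⊆ᵇ⇒∣∣≤ : ∀ {k} (s t : Subset k) → s ⊆ᵇ t ≡ true → ∣ s ∣ ≤ ∣ t ∣
⊆ᵇ⇒∣∣≤ []          []          _   = z≤n
⊆ᵇ⇒∣∣≤ (true  ∷ s) (true  ∷ t) s⊆t = s≤s (⊆ᵇ⇒∣∣≤ s t s⊆t)
⊆ᵇ⇒∣∣≤ (false ∷ s) (true  ∷ t) s⊆t = ℕ.m≤n⇒m≤1+n (⊆ᵇ⇒∣∣≤ s t s⊆t)
⊆ᵇ⇒∣∣≤ (false ∷ s) (false ∷ t) s⊆t = ⊆ᵇ⇒∣∣≤ s t s⊆t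

⊆ᵇ⇒lookup : ∀ {k} (s t : Subset k) → s ⊆ᵇ t ≡ true → ∀ a → lookup s a ≡ true → lookup t a ≡ true
⊆ᵇ⇒lookup (true ∷ s) (true ∷ t) s⊆t zero    _  = refl
⊆ᵇ⇒lookup (b ∷ s)    (c ∷ t)    s⊆t (suc a) sa = ⊆ᵇ⇒lookup s t (proj₂ (∧-true⁻ (not b ∨ c) s⊆t)) a sa

lookup⇒⊆ᵇ : ∀ {k} (s t : Subset k) → (∀ a → lookup s a ≡ true → lookup t a ≡ true) → s ⊆ᵇ t ≡ true
lookup⇒⊆ᵇ []          []      _   = refl
lookup⇒⊆ᵇ (true  ∷ s) (c ∷ t) s⊆t rewrite s⊆t zero refl = lookup⇒⊆ᵇ s t (s⊆t ∘ suc)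
lookup⇒⊆ᵇ (false ∷ s) (c ∷ t) s⊆t = lookup⇒⊆ᵇ s t (s⊆t ∘ suc)

suc≡ᵇ-false : ∀ {m t} → m ≤ t → (suc t ≡ᵇ m) ≡ false
suc≡ᵇ-false {zero}  _         = refl
suc≡ᵇ-false {suc m} (s≤s m≤t) = suc≡ᵇ-false m≤t

fromList : ∀ {k} → List (Fin k) → Subset k
fromList []       = ⊥
fromList (x ∷ xs) = fromList xs [ x ]≔ true

lookup-fromList⁻ : ∀ {k} (xs : List (Fin k)) a → lookup (fromList xs) a ≡ true → a ∈ xs
lookup-fromList⁻ []       a a∈⊥ = contradiction (trans (sym a∈⊥) (lookup-replicate a false)) λ ()
lookup-fromList⁻ (x ∷ xs) a a∈ with a ≟ x
... | yes refl = here refl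
... | no  a≢x  = there (lookup-fromList⁻ xs a (trans (sym (lookup∘update′ a≢x (fromList xs) true)) a∈))

lookup-fromList⁺ : ∀ {k} (xs : List (Fin k)) a → a ∈ xs → lookup (fromList xs) a ≡ true
lookup-fromList⁺ (x ∷ xs) a (here refl) = lookup∘update a (fromList xs) true
lookup-fromList⁺ (x ∷ xs) a (there a∈xs) with a ≟ x
... | yes refl = lookup∘update a (fromList xs) true
... | no  a≢x  = trans (lookup∘update′ a≢x (fromList xs) true) (lookup-fromList⁺ xs a a∈xs)

∣[]≔true∣ : ∀ {k} (s : Subset k) x → lookup s x ≡ false → ∣ s [ x ]≔ true ∣ ≡ suc ∣ s ∣
∣[]≔true∣ (false ∷ s) zero    _   = refl
∣[]≔true∣ (true  ∷ s) (suc x) x∉s = cong suc (∣[]≔true∣ s x x∉s)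
∣[]≔true∣ (false ∷ s) (suc x) x∉s = ∣[]≔true∣ s x x∉s

∣fromList∣ : ∀ {k} (xs : List (Fin k)) → Unique xs → ∣ fromList xs ∣ ≡ length xs
∣fromList∣ {k} []       _             = ∣⊥∣≡0 k
∣fromList∣     (x ∷ xs) (x≢xs ∷ uxs) =
  trans (∣[]≔true∣ (fromList xs) x (¬-not (λ x∈ → All.lookup x≢xs (lookup-fromList⁻ xs x x∈) refl)))
    (cong suc (∣fromList∣ xs uxs))

lookup-[]≔true⁻ : ∀ {k} (s : Subset k) v a → lookup (s [ v ]≔ true) a ≡ true → a ≡ v ⊎ lookup s a ≡ true
lookup-[]≔true⁻ s v a a∈ with a ≟ v
... | yes a≡v = inj₁ a≡v
... | no  a≢v = inj₂ (trans (sym (lookup∘update′ a≢v s true)) a∈)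

-- Cliques, their extensions and the weights W

module _ (G : Graph) where
  open Graph G renaming (sym to adj-sym)

  allᵇ-↭ : ∀ (p : V G → Bool) {xs ys} → xs ↭ ys → allᵇ G p xs ≡ allᵇ G p ys
  allᵇ-↭ p ↭.refl                         = refl
  allᵇ-↭ p (↭.prep x xs↭ys)               = cong (p x ∧_) (allᵇ-↭ p xs↭ys)
  allᵇ-↭ p (↭.swap {xs} {ys} x y xs↭ys)   =
    trans (∧-swapˡ (p x) (p y) (allᵇ G p xs)) (cong (λ b → p y ∧ (p x ∧ b)) (allᵇ-↭ p xs↭ys))
  allᵇ-↭ p (↭.trans xs↭ys ys↭zs)          = trans (allᵇ-↭ p xs↭ys) (allᵇ-↭ p ys↭zs)

  isClique-↭ : ∀ {xs ys} → xs ↭ ys → isClique G xs ≡ isClique G ys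
  isClique-↭ ↭.refl                       = refl
  isClique-↭ (↭.prep x xs↭ys)             = cong₂ _∧_ (allᵇ-↭ (adj x) xs↭ys) (isClique-↭ xs↭ys)
  isClique-↭ (↭.swap {xs} {ys} x y xs↭ys) = begin
    (adj x y ∧ allᵇ G (adj x) xs) ∧ (allᵇ G (adj y) xs ∧ isClique G xs)
      ≡⟨ ∧-interchange (adj x y) _ _ _ ⟩
    (adj x y ∧ allᵇ G (adj y) xs) ∧ (allᵇ G (adj x) xs ∧ isClique G xs)
      ≡⟨ cong (λ e → (e ∧ allᵇ G (adj y) xs) ∧ (allᵇ G (adj x) xs ∧ isClique G xs)) (adj-sym x y) ⟩
    (adj y x ∧ allᵇ G (adj y) xs) ∧ (allᵇ G (adj x) xs ∧ isClique G xs)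
      ≡⟨ cong₂ (λ a b → (adj y x ∧ a) ∧ b) (allᵇ-↭ (adj y) xs↭ys)
           (cong₂ _∧_ (allᵇ-↭ (adj x) xs↭ys) (isClique-↭ xs↭ys)) ⟩
    (adj y x ∧ allᵇ G (adj y) ys) ∧ (allᵇ G (adj x) ys ∧ isClique G ys)
      ∎
    where open ≡-Reasoning
  isClique-↭ (↭.trans xs↭ys ys↭zs)        = trans (isClique-↭ xs↭ys) (isClique-↭ ys↭zs)

  cntK-↭ : ∀ ℓ {xs ys} → xs ↭ ys → cntK G ℓ xs ≡ cntK G ℓ ys
  cntK-↭ ℓ xs↭ys = cong length (filterᵇ-cong
    (λ T → cong (λ b → (∣ T ∣ ≡ᵇ ℓ) ∧ isClique G (elems G T) ∧ b) (allᵇ-↭ (lookup T) xs↭ys))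
    (allSubsets G n))

  W-swap : ∀ a b r → W G (a ∷ b ∷ r) ≡ W G (b ∷ a ∷ r)
  W-swap a b r = cong (prodℚ G) (map-cong factor (upTo (suc (length r))))
    where
      take-swap : ∀ k → take (k ℕ.+ 2) (a ∷ b ∷ r) ↭ take (k ℕ.+ 2) (b ∷ a ∷ r)
      take-swap k rewrite ℕ.+-comm k 2 = ↭.swap a b ↭.refl
      factor : ∀ k → inv G (cntK G (k ℕ.+ 3) (take (k ℕ.+ 2) (a ∷ b ∷ r))) ≡ inv G (cntK G (k ℕ.+ 3) (take (k ℕ.+ 2) (b ∷ a ∷ r)))
      factor k = cong (inv G) (cntK-↭ (k ℕ.+ 3) (take-swap k))

  count-allSubsets-suc : ∀ k (P : Subset (suc k) → Bool) →
    count P (allSubsets G (suc k)) ≡ count (P ∘ (true ∷_)) (allSubsets G k) ℕ.+ count (P ∘ (false ∷_)) (allSubsets G k)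
  count-allSubsets-suc k P = trans (count-++ P (map (true ∷_) (allSubsets G k)) _)
    (cong₂ ℕ._+_ (count-map P (true ∷_) (allSubsets G k))
      (trans (count-++ P (map (false ∷_) (allSubsets G k)) [])
        (trans (ℕ.+-identityʳ _) (count-map P (false ∷_) (allSubsets G k)))))

  count-supersets-of-same-size : ∀ k (S : Subset k) (P : Subset k → Bool) →
    count (λ T → (∣ T ∣ ≡ᵇ ∣ S ∣) ∧ P T ∧ (S ⊆ᵇ T)) (allSubsets G k) ≡ (if P S then 1 else 0)
  count-supersets-of-same-size zero [] P with P []
  ... | true  = refl
  ... | false = refl
  count-supersets-of-same-size (suc k) (true ∷ S) P = begin
    count _ (allSubsets G (suc k))
      ≡⟨ count-allSubsets-suc k _ ⟩
    count _ (allSubsets G k) ℕ.+ count _ (allSubsets G k)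
      ≡⟨ cong₂ ℕ._+_ (count-supersets-of-same-size k S (P ∘ (true ∷_)))
           (trans (count-cong (λ T → ∧∧false (∣ T ∣ ≡ᵇ suc ∣ S ∣) (P (false ∷ T))) (allSubsets G k)) (count-false (allSubsets G k))) ⟩
    (if P (true ∷ S) then 1 else 0) ℕ.+ 0
      ≡⟨ ℕ.+-identityʳ _ ⟩
    (if P (true ∷ S) then 1 else 0)
      ∎
    where open ≡-Reasoning
  count-supersets-of-same-size (suc k) (false ∷ S) P =
    trans (count-allSubsets-suc k _)
      (cong₂ ℕ._+_ (trans (count-cong none (allSubsets G k)) (count-false (allSubsets G k)))
        (count-supersets-of-same-size k S (P ∘ (false ∷_))))
    where
      none : ∀ T → ((suc ∣ T ∣ ≡ᵇ ∣ S ∣) ∧ P (true ∷ T) ∧ (S ⊆ᵇ T)) ≡ false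
      none T with S ⊆ᵇ T in S⊆T
      ... | false = ∧∧false (suc ∣ T ∣ ≡ᵇ ∣ S ∣) (P (true ∷ T))
      ... | true rewrite suc≡ᵇ-false (⊆ᵇ⇒∣∣≤ S T S⊆T) = refl

  count-supersets-of-size-suc : ∀ k (S : Subset k) (P : Subset k → Bool) →
    count (λ T → (∣ T ∣ ≡ᵇ suc ∣ S ∣) ∧ P T ∧ (S ⊆ᵇ T)) (allSubsets G k)
      ≡ count (λ v → not (lookup S v) ∧ P (S [ v ]≔ true)) (allFin k)
  count-supersets-of-size-suc zero [] P = refl
  count-supersets-of-size-suc (suc k) (true ∷ S) P = begin
    count _ (allSubsets G (suc k))
      ≡⟨ count-allSubsets-suc k _ ⟩
    count _ (allSubsets G k) ℕ.+ count _ (allSubsets G k)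
      ≡⟨ cong₂ ℕ._+_ (count-supersets-of-size-suc k S (P ∘ (true ∷_)))
           (trans (count-cong (λ T → ∧∧false (∣ T ∣ ≡ᵇ suc (suc ∣ S ∣)) (P (false ∷ T))) (allSubsets G k)) (count-false (allSubsets G k))) ⟩
    count _ (allFin k) ℕ.+ 0
      ≡⟨ ℕ.+-identityʳ _ ⟩
    count _ (allFin k)
      ≡⟨ count-allFin-suc k (λ v → not (lookup (true ∷ S) v) ∧ P ((true ∷ S) [ v ]≔ true)) ⟨
    count (λ v → not (lookup (true ∷ S) v) ∧ P ((true ∷ S) [ v ]≔ true)) (allFin (suc k))
      ∎
    where open ≡-Reasoning
  count-supersets-of-size-suc (suc k) (false ∷ S) P =
    trans (count-allSubsets-suc k _)
      (trans (cong₂ ℕ._+_ (count-supersets-of-same-size k S (P ∘ (true ∷_))) (count-supersets-of-size-suc k S (P ∘ (false ∷_))))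
        (sym (count-allFin-suc k (λ v → not (lookup (false ∷ S) v) ∧ P ((false ∷ S) [ v ]≔ true)))))

  ∈-elems⁻ : ∀ {k} (U : Subset k) {a} → a ∈ elems G U → lookup U a ≡ true
  ∈-elems⁻ (true ∷ U) (here refl) = refl
  ∈-elems⁻ (true ∷ U) (there a∈) with ∈-map⁻ suc a∈
  ... | _ , a∈U , refl = ∈-elems⁻ U a∈U
  ∈-elems⁻ (false ∷ U) a∈ with ∈-map⁻ suc a∈
  ... | _ , a∈U , refl = ∈-elems⁻ U a∈U

  ∈-elems⁺ : ∀ {k} (U : Subset k) a → lookup U a ≡ true → a ∈ elems G U
  ∈-elems⁺ (true  ∷ U) zero    _  = here refl
  ∈-elems⁺ (true  ∷ U) (suc a) a∈ = there (∈-map⁺ suc (∈-elems⁺ U a a∈))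
  ∈-elems⁺ (false ∷ U) (suc a) a∈ = ∈-map⁺ suc (∈-elems⁺ U a a∈)

  elems-Unique : ∀ {k} (U : Subset k) → Unique (elems G U)
  elems-Unique []          = []
  elems-Unique (true  ∷ U) = All.tabulate zero∉ ∷ Unique.map⁺ suc-injective (elems-Unique U)
    where
      zero∉ : ∀ {b} → b ∈ map suc (elems G U) → zero ≢ b
      zero∉ b∈ with ∈-map⁻ suc b∈
      ... | _ , _ , refl = λ ()
  elems-Unique (false ∷ U) = Unique.map⁺ suc-injective (elems-Unique U)

  adj⇒≢ : ∀ {a b} → adj a b ≡ true → a ≢ b
  adj⇒≢ {a} adj-aa refl with trans (sym adj-aa) (irref a)
  ... | ()

  allᵇ⇒All : ∀ {p : V G → Bool} xs → allᵇ G p xs ≡ true → All (λ y → p y ≡ true) xs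
  allᵇ⇒All         []       _   = []
  allᵇ⇒All {p = p} (x ∷ xs) all with ∧-true⁻ (p x) all
  ... | px , pxs = px ∷ allᵇ⇒All xs pxs

  All⇒allᵇ : ∀ {p : V G → Bool} {xs} → All (λ y → p y ≡ true) xs → allᵇ G p xs ≡ true
  All⇒allᵇ []         = refl
  All⇒allᵇ (px ∷ pxs) = ∧-true⁺ px (All⇒allᵇ pxs)

  isClique⇒Unique : ∀ xs → isClique G xs ≡ true → Unique xs
  isClique⇒Unique []       _  = []
  isClique⇒Unique (x ∷ xs) cl with ∧-true⁻ (allᵇ G (adj x) xs) cl
  ... | x~xs , cl-xs = All.map adj⇒≢ (allᵇ⇒All xs x~xs) ∷ isClique⇒Unique xs cl-xs

  isClique⇒adj : ∀ xs → isClique G xs ≡ true → ∀ {a b} → a ∈ xs → b ∈ xs → a ≢ b → adj a b ≡ true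
  isClique⇒adj (x ∷ xs) cl a∈ b∈ a≢b with ∧-true⁻ (allᵇ G (adj x) xs) cl
  isClique⇒adj (x ∷ xs) cl (here refl) (here refl) a≢b | _ = contradiction refl a≢b
  isClique⇒adj (x ∷ xs) cl (here refl) (there b∈) a≢b | x~xs , _ = All.lookup (allᵇ⇒All xs x~xs) b∈
  isClique⇒adj (x ∷ xs) cl (there a∈) (here refl) a≢b | x~xs , _ = trans (adj-sym _ x) (All.lookup (allᵇ⇒All xs x~xs) a∈)
  isClique⇒adj (x ∷ xs) cl (there a∈) (there b∈) a≢b | _ , cl-xs = isClique⇒adj xs cl-xs a∈ b∈ a≢b

  adj⇒isClique : ∀ xs → Unique xs → (∀ {a b} → a ∈ xs → b ∈ xs → a ≢ b → adj a b ≡ true) → isClique G xs ≡ true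
  adj⇒isClique []       _            _   = refl
  adj⇒isClique (x ∷ xs) (x≢xs ∷ uxs) adj = ∧-true⁺
    (All⇒allᵇ (All.tabulate λ b∈ → adj (here refl) (there b∈) (All.lookup x≢xs b∈)))
    (adj⇒isClique xs uxs λ a∈ b∈ → adj (there a∈) (there b∈))

  allᵇ-lookup≡⊆ᵇ : ∀ (T : Subset n) xs → allᵇ G (lookup T) xs ≡ (fromList xs ⊆ᵇ T)
  allᵇ-lookup≡⊆ᵇ T xs = ⇔→≡ (mk⇔
    (λ all → lookup⇒⊆ᵇ (fromList xs) T λ a a∈ → All.lookup (allᵇ⇒All xs all) (lookup-fromList⁻ xs a a∈))
    (λ xs⊆T → All⇒allᵇ (All.tabulate λ {a} a∈ → ⊆ᵇ⇒lookup (fromList xs) T xs⊆T a (lookup-fromList⁺ xs a a∈))))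

  extends-clique : ∀ xs v → isClique G xs ≡ true →
    (not (lookup (fromList xs) v) ∧ isClique G (elems G (fromList xs [ v ]≔ true))) ≡ allᵇ G (adj v) xs
  extends-clique xs v cl = ⇔→≡ (mk⇔ to from)
    where
      s = fromList xs
      U = s [ v ]≔ true
      v∈U : lookup U v ≡ true
      v∈U = lookup∘update v s true
      to : _ ≡ true → allᵇ G (adj v) xs ≡ true
      to h with ∧-true⁻ (not (lookup s v)) h
      ... | v∉s , cl-U = All⇒allᵇ (All.tabulate λ {b} b∈ →
        let b≢v : b ≢ v
            b≢v = λ { refl → contradiction (trans (sym (lookup-fromList⁺ xs b b∈)) (not≡true⁻ v∉s)) λ () }
        in isClique⇒adj (elems G U) cl-U (∈-elems⁺ U v v∈U)
             (∈-elems⁺ U b (trans (lookup∘update′ b≢v s true) (lookup-fromList⁺ xs b b∈))) (b≢v ∘ sym))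
      from : allᵇ G (adj v) xs ≡ true → _ ≡ true
      from h = ∧-true⁺ v∉s (adj⇒isClique (elems G U) (elems-Unique U) λ a∈ b∈ → adjacent (∈-elems⁻ U a∈) (∈-elems⁻ U b∈))
        where
          v~xs = allᵇ⇒All xs h
          v∉s : not (lookup s v) ≡ true
          v∉s with lookup s v in v∈s
          ... | true  = contradiction refl (adj⇒≢ (All.lookup v~xs (lookup-fromList⁻ xs v v∈s)))
          ... | false = refl
          adjacent : ∀ {a b} → lookup U a ≡ true → lookup U b ≡ true → a ≢ b → adj a b ≡ true
          adjacent {a} {b} a∈ b∈ a≢b with lookup-[]≔true⁻ s v a a∈ | lookup-[]≔true⁻ s v b b∈
          ... | inj₁ refl | inj₁ refl = contradiction refl a≢b
          ... | inj₁ refl | inj₂ b∈s  = All.lookup v~xs (lookup-fromList⁻ xs b b∈s)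
          ... | inj₂ a∈s  | inj₁ refl = trans (adj-sym a v) (All.lookup v~xs (lookup-fromList⁻ xs a a∈s))
          ... | inj₂ a∈s  | inj₂ b∈s  = isClique⇒adj xs cl (lookup-fromList⁻ xs a a∈s) (lookup-fromList⁻ xs b b∈s) a≢b

  -- An (|xs|+1)-clique containing the clique xs is xs ∪ {v} for exactly one common neighbour v.
  cntK≡count-common-neighbours : ∀ xs → isClique G xs ≡ true →
    cntK G (suc (length xs)) xs ≡ count (λ v → allᵇ G (adj v) xs) (allFin n)
  cntK≡count-common-neighbours xs cl = begin
    cntK G (suc (length xs)) xs
      ≡⟨ count-cong as-superset (allSubsets G n) ⟩
    count (λ T → (∣ T ∣ ≡ᵇ suc ∣ fromList xs ∣) ∧ isClique G (elems G T) ∧ (fromList xs ⊆ᵇ T)) (allSubsets G n)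
      ≡⟨ count-supersets-of-size-suc n (fromList xs) (λ T → isClique G (elems G T)) ⟩
    count (λ v → not (lookup (fromList xs) v) ∧ isClique G (elems G (fromList xs [ v ]≔ true))) (allFin n)
      ≡⟨ count-cong (λ v → extends-clique xs v cl) (allFin n) ⟩
    count (λ v → allᵇ G (adj v) xs) (allFin n)
      ∎
    where
      open ≡-Reasoning
      as-superset : ∀ T → ((∣ T ∣ ≡ᵇ suc (length xs)) ∧ isClique G (elems G T) ∧ allᵇ G (lookup T) xs)
                        ≡ ((∣ T ∣ ≡ᵇ suc ∣ fromList xs ∣) ∧ isClique G (elems G T) ∧ (fromList xs ⊆ᵇ T))
      as-superset T = cong₂ (λ m b → (∣ T ∣ ≡ᵇ suc m) ∧ isClique G (elems G T) ∧ b)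
        (sym (∣fromList∣ xs (isClique⇒Unique xs cl))) (allᵇ-lookup≡⊆ᵇ T xs)

  W-snoc₃ : ∀ a b c → W G (a ∷ b ∷ c ∷ []) ≡ W G (a ∷ b ∷ []) * inv G (cntK G 4 (a ∷ b ∷ c ∷ []))
  W-snoc₃ a b c = trans (cong (i₃ *_) (*-identityʳ i₄)) (cong (_* i₄) (sym (*-identityʳ i₃)))
    where i₃ = inv G (cntK G 3 (a ∷ b ∷ []))
          i₄ = inv G (cntK G 4 (a ∷ b ∷ c ∷ []))

  W-snoc₄ : ∀ a b c d → W G (a ∷ b ∷ c ∷ d ∷ []) ≡ W G (a ∷ b ∷ c ∷ []) * inv G (cntK G 5 (a ∷ b ∷ c ∷ d ∷ []))
  W-snoc₄ a b c d = trans (cong (λ x → i₃ * (i₄ * x)) (*-identityʳ i₅))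
    (trans (sym (*-assoc i₃ i₄ i₅)) (cong (λ x → (i₃ * x) * i₅) (sym (*-identityʳ i₄))))
    where i₃ = inv G (cntK G 3 (a ∷ b ∷ []))
          i₄ = inv G (cntK G 4 (a ∷ b ∷ c ∷ []))
          i₅ = inv G (cntK G 5 (a ∷ b ∷ c ∷ d ∷ []))

  sumOn-extensions-cancel : WellDefined G → ∀ xs → isClique G xs ≡ true →
    (length xs ≡ 2 ⊎ length xs ≡ 3 ⊎ length xs ≡ 4) → ∀ c →
    sumOn (λ v → allᵇ G (adj v) xs) (λ _ → c * inv G (cntK G (suc (length xs)) xs)) ≡ c
  sumOn-extensions-cancel wd xs cl len c
    rewrite sumOn-const (λ v → allᵇ G (adj v) xs) (c * inv G (cntK G (suc (length xs)) xs))
          | sym (cntK≡count-common-neighbours xs cl)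
    with cntK G (suc (length xs)) xs | wd xs cl len
  ... | zero  | nonzero = contradiction refl nonzero
  ... | suc m | _       = trans (*-assoc c _ _) (trans (cong (c *_) (1/n*n≡1 m)) (*-identityʳ c))

  eqV-refl : ∀ x → eqV G x x ≡ true
  eqV-refl x with x ≟ x
  ... | yes _   = refl
  ... | no  x≢x = contradiction refl x≢x

  eqV-≢ : ∀ {x y} → x ≢ y → eqV G x y ≡ false
  eqV-≢ {x} {y} x≢y with x ≟ y
  ... | yes x≡y = contradiction x≡y x≢y
  ... | no  _   = refl

  -- Sums over the tuples containing a prescribed subsequence

  -- The sum of F over all lists obtained from xs by inserting s further vertices.
  interleavedSum : List (V G) → ℕ → (List (V G) → ℚ) → ℚ
  interleavedSum []       zero    F = F []
  interleavedSum []       (suc s) F = sum λ v → interleavedSum [] s (F ∘ (v ∷_))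
  interleavedSum (x ∷ xs) zero    F = interleavedSum xs zero (F ∘ (x ∷_))
  interleavedSum (x ∷ xs) (suc s) F =
    interleavedSum xs (suc s) (F ∘ (x ∷_)) + sum λ v → interleavedSum (x ∷ xs) s (F ∘ (v ∷_))

  CliqueSupported : (List (V G) → ℚ) → Set
  CliqueSupported F = ∀ t → isClique G t ≡ false → F t ≡ 0ℚ

  sumMap-tuples-suc : ∀ k (F : List (V G) → ℚ) → sumMap F (tuples G (suc k)) ≡ sum λ v → sumMap (F ∘ (v ∷_)) (tuples G k)
  sumMap-tuples-suc k F = trans (sumMap-concatMap F (λ v → map (v ∷_) (tuples G k)) (allFin n))
    (trans (sumMap-cong (λ v → sumMap-map F (v ∷_) (tuples G k)) (allFin n)) (sumMap-allFin λ v → sumMap (F ∘ (v ∷_)) (tuples G k)))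

  isSubseq⇒¬allᵇ-adj : ∀ x xs t → isSubseq G (x ∷ xs) t ≡ true → allᵇ G (adj x) t ≡ false
  isSubseq⇒¬allᵇ-adj x xs (y ∷ t) x⊑y∷t with x ≟ y
  ... | yes refl rewrite irref x = refl
  ... | no  _    = trans (cong (adj x y ∧_) (isSubseq⇒¬allᵇ-adj x xs t x⊑y∷t)) (∧-zeroʳ (adj x y))

  CliqueSupported-∷ : ∀ {F} → CliqueSupported F → ∀ v → CliqueSupported (F ∘ (v ∷_))
  CliqueSupported-∷ supp v t ¬cl = supp (v ∷ t) (trans (cong (allᵇ G (adj v) t ∧_) ¬cl) (∧-zeroʳ _))

  sumMap-isSubseq-short : ∀ ys k (H : List (V G) → ℚ) → k < length ys →
    sumMap (λ t → when (isSubseq G ys t) (H t)) (tuples G k) ≡ 0ℚ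
  sumMap-isSubseq-short (y ∷ ys) zero    H _         = refl
  sumMap-isSubseq-short (y ∷ ys) (suc k) H (s≤s k<) =
    trans (sumMap-tuples-suc k _) (trans (sum-cong-≗ vanishes) (sum-zero {n}))
    where
      vanishes : ∀ v → sumMap (λ t → when (isSubseq G (y ∷ ys) (v ∷ t)) (H (v ∷ t))) (tuples G k) ≡ 0ℚ
      vanishes v with eqV G y v
      ... | true  = sumMap-isSubseq-short ys k (H ∘ (v ∷_)) k<
      ... | false = sumMap-isSubseq-short (y ∷ ys) k (H ∘ (v ∷_)) (ℕ.m<n⇒m<1+n k<)

  -- Split by whether the head of t is the first entry x of the embedded subsequence: the head
  -- cannot be another copy of x, since F vanishes off cliques.
  sumMap-isSubseq-∷ : ∀ {F} → CliqueSupported F → ∀ x xs k →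
    sumMap (λ t → when (isSubseq G (x ∷ xs) t) (F t)) (tuples G (suc k))
      ≡ sumMap (λ t → when (isSubseq G xs t) (F (x ∷ t))) (tuples G k)
        + sum (λ v → sumMap (λ t → when (isSubseq G (x ∷ xs) t) (F (v ∷ t))) (tuples G k))
  sumMap-isSubseq-∷ {F} supp x xs k =
    trans (sumMap-tuples-suc k _)
      (trans (sum-cong-≗ λ v → sumMap-when-if (eqV G x v) (isSubseq G xs) (isSubseq G (x ∷ xs)) (F ∘ (v ∷_)) (tuples G k))
             (sum-if-≟ x placed skipped skipped-x≡0))
    where
      placed skipped : V G → ℚ
      placed  v = sumMap (λ t → when (isSubseq G xs t) (F (v ∷ t))) (tuples G k)
      skipped v = sumMap (λ t → when (isSubseq G (x ∷ xs) t) (F (v ∷ t))) (tuples G k)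
      vanishes : ∀ t → when (isSubseq G (x ∷ xs) t) (F (x ∷ t)) ≡ 0ℚ
      vanishes t with isSubseq G (x ∷ xs) t in x⊑t
      ... | true  = supp (x ∷ t) (cong (_∧ isClique G t) (isSubseq⇒¬allᵇ-adj x xs t x⊑t))
      ... | false = refl
      skipped-x≡0 : skipped x ≡ 0ℚ
      skipped-x≡0 = trans (sumMap-cong vanishes (tuples G k)) (sumMap-zero (tuples G k))

  sumMap-isSubseq≡interleavedSum : ∀ {F} → CliqueSupported F → ∀ xs s →
    sumMap (λ t → when (isSubseq G xs t) (F t)) (tuples G (length xs ℕ.+ s)) ≡ interleavedSum xs s F
  sumMap-isSubseq≡interleavedSum {F} supp []       zero    = +-identityʳ (F [])
  sumMap-isSubseq≡interleavedSum {F} supp []       (suc s) = trans (sumMap-tuples-suc s _)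
    (sum-cong-≗ λ v → sumMap-isSubseq≡interleavedSum (CliqueSupported-∷ supp v) [] s)
  sumMap-isSubseq≡interleavedSum {F} supp (x ∷ xs) zero    =
    trans (sumMap-isSubseq-∷ supp x xs k)
      (trans (cong₂ _+_ (sumMap-isSubseq≡interleavedSum (CliqueSupported-∷ supp x) xs zero) x-later-impossible)
        (+-identityʳ _))
    where
      k : ℕ
      k = length xs ℕ.+ zero
      x-later-impossible : sum (λ v → sumMap (λ t → when (isSubseq G (x ∷ xs) t) (F (v ∷ t))) (tuples G k)) ≡ 0ℚ
      x-later-impossible = trans
        (sum-cong-≗ λ v → sumMap-isSubseq-short (x ∷ xs) k (F ∘ (v ∷_)) (s≤s (ℕ.≤-reflexive (ℕ.+-identityʳ (length xs)))))
        (sum-zero {n})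
  sumMap-isSubseq≡interleavedSum {F} supp (x ∷ xs) (suc s) =
    trans (sumMap-isSubseq-∷ supp x xs (length xs ℕ.+ suc s))
      (cong₂ _+_ (sumMap-isSubseq≡interleavedSum (CliqueSupported-∷ supp x) xs (suc s)) (sum-cong-≗ x-later))
    where
      x-later : ∀ v → sumMap (λ t → when (isSubseq G (x ∷ xs) t) (F (v ∷ t))) (tuples G (length xs ℕ.+ suc s))
                    ≡ interleavedSum (x ∷ xs) s (F ∘ (v ∷_))
      x-later v rewrite ℕ.+-suc (length xs) s = sumMap-isSubseq≡interleavedSum (CliqueSupported-∷ supp v) (x ∷ xs) s

module Lemma3-15 (G : Graph) (wd : WellDefined G) (x₁ x₂ x₃ : V G) (cl : isClique G (x₁ ∷ x₂ ∷ x₃ ∷ []) ≡ true) where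
  open Graph G renaming (sym to adj-sym)

  O : List (V G)
  O = x₁ ∷ x₂ ∷ x₃ ∷ []

  summand : List (V G) → ℚ
  summand K = when (isClique G K) (W G (take 4 K) * ψ G x₁ x₂ x₃ K)

  summand-supported : CliqueSupported G summand
  summand-supported K ¬cl rewrite ¬cl = refl

  w≡½interleavedSum : w G x₁ x₂ x₃ ≡ (+ 1 / 2) * interleavedSum G O 2 summand
  w≡½interleavedSum = cong ((+ 1 / 2) *_) (begin
    sumMap (λ K → W G (take 4 K) * ψ G x₁ x₂ x₃ K) (OK5 G x₁ x₂ x₃)
      ≡⟨ sumMap-filterᵇ _ _ (tuples G 5) ⟩
    sumMap (λ K → when (isClique G K ∧ isSubseq G O K) (W G (take 4 K) * ψ G x₁ x₂ x₃ K)) (tuples G 5)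
      ≡⟨ sumMap-cong (λ K → when-∧-swap (isClique G K) (isSubseq G O K) _) (tuples G 5) ⟩
    sumMap (λ K → when (isSubseq G O K) (summand K)) (tuples G 5)
      ≡⟨ sumMap-isSubseq≡interleavedSum G summand-supported O 2 ⟩
    interleavedSum G O 2 summand
      ∎)
    where open ≡-Reasoning

  inR′ : V G → Bool
  inR′ = inR G x₁ x₂ x₃

  allᵇ-adj-O≡inR : ∀ y → allᵇ G (adj y) O ≡ inR′ y
  allᵇ-adj-O≡inR y rewrite adj-sym y x₁ | adj-sym y x₂ | adj-sym y x₃ =
    cong (λ b → adj x₁ y ∧ adj x₂ y ∧ b) (∧-identityʳ (adj x₃ y))

  isClique-∷O : ∀ y → isClique G (y ∷ O) ≡ inR′ y
  isClique-∷O y = trans (cong (allᵇ G (adj y) O ∧_) cl) (trans (∧-identityʳ _) (allᵇ-adj-O≡inR y))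

  isClique-∷∷O : ∀ y z → isClique G (y ∷ z ∷ O) ≡ inR′ y ∧ (adj y z ∧ inR′ z)
  isClique-∷∷O y z rewrite isClique-∷O z | allᵇ-adj-O≡inR y =
    trans (∧-assoc (adj y z) (inR′ y) (inR′ z)) (∧-swapˡ (adj y z) (inR′ y) (inR′ z))

  x₁∈O : memO G x₁ x₂ x₃ x₁ ≡ true
  x₁∈O rewrite eqV-refl G x₁ = refl

  x₂∈O : memO G x₁ x₂ x₃ x₂ ≡ true
  x₂∈O rewrite eqV-refl G x₂ = ∨-zeroʳ (eqV G x₂ x₁)

  R∌O : ∀ {y} → inR′ y ≡ true → memO G x₁ x₂ x₃ y ≡ false
  R∌O {y} y∈R with ∧-true⁻ (adj x₁ y) y∈R
  ... | x₁~y , rest with ∧-true⁻ (adj x₂ y) rest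
  ... | x₂~y , x₃~y
    rewrite eqV-≢ G (adj⇒≢ G x₁~y ∘ sym) | eqV-≢ G (adj⇒≢ G x₂~y ∘ sym) | eqV-≢ G (adj⇒≢ G x₃~y ∘ sym) = refl

  coefficient : ℕ → ℚ
  coefficient 1 = - (+ 1 / 6)
  coefficient _ = + 1 / 3

  ψ≡coefficient : ∀ K → ψ G x₁ x₂ x₃ K ≡ coefficient (interSize G x₁ x₂ x₃ K)
  ψ≡coefficient K with interSize G x₁ x₂ x₃ K
  ... | 0           = refl
  ... | 1           = refl
  ... | suc (suc _) = refl

  ψ-∷∷ : ∀ a b r {α β} → memO G x₁ x₂ x₃ a ≡ α → memO G x₁ x₂ x₃ b ≡ β →
    ψ G x₁ x₂ x₃ (a ∷ b ∷ r) ≡ coefficient ((if α then 1 else 0) ℕ.+ (if β then 1 else 0))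
  ψ-∷∷ a b r refl refl = ψ≡coefficient (a ∷ b ∷ r)

  sum-last-vertex : ∀ a b c d (k : ℚ) →
    (isClique G (a ∷ b ∷ c ∷ d ∷ []) ≡ true → ∀ e → ψ G x₁ x₂ x₃ (a ∷ b ∷ c ∷ d ∷ e ∷ []) ≡ k) →
    sum (λ e → summand (a ∷ b ∷ c ∷ d ∷ e ∷ [])) ≡ when (isClique G (a ∷ b ∷ c ∷ d ∷ [])) (k * W G (a ∷ b ∷ c ∷ []))
  sum-last-vertex a b c d k ψ≡k with isClique G p in cl-p
    where p = a ∷ b ∷ c ∷ d ∷ []
  ... | false = trans (sum-cong-≗ vanishes) (sum-zero {n})
    where
      vanishes : ∀ e → summand (a ∷ b ∷ c ∷ d ∷ e ∷ []) ≡ 0ℚ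
      vanishes e = summand-supported (a ∷ b ∷ c ∷ d ∷ e ∷ [])
        (trans (isClique-↭ G (shift e (a ∷ b ∷ c ∷ d ∷ []) [])) (trans (cong (allᵇ G (adj e) (a ∷ b ∷ c ∷ d ∷ []) ∧_) cl-p) (∧-zeroʳ _)))
  ... | true  = trans (sum-cong-≗ reweigh) (sumOn-extensions-cancel G wd p cl-p (inj₂ (inj₂ refl)) (k * W G (a ∷ b ∷ c ∷ [])))
    where
      p = a ∷ b ∷ c ∷ d ∷ []
      reweigh : ∀ e → summand (a ∷ b ∷ c ∷ d ∷ e ∷ [])
                    ≡ when (allᵇ G (adj e) p) ((k * W G (a ∷ b ∷ c ∷ [])) * inv G (cntK G 5 p))
      reweigh e = trans
        (cong (λ β → when β (W G p * ψ G x₁ x₂ x₃ (a ∷ b ∷ c ∷ d ∷ e ∷ []))) (trans (isClique-↭ G (shift e p [])) (trans (cong (allᵇ G (adj e) p ∧_) cl-p) (∧-identityʳ _))))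
        (when-cong (allᵇ G (adj e) p) λ _ →
          trans (cong₂ _*_ (W-snoc₄ G a b c d) (ψ≡k refl e)) (*-rotate (W G (a ∷ b ∷ c ∷ [])) (inv G (cntK G 5 p)) k))

  sum-leaf-x₁x₂x₃ : sum (λ y → sum (λ z → summand (x₁ ∷ x₂ ∷ x₃ ∷ y ∷ z ∷ []))) ≡ (+ 1 / 3) * W G (x₁ ∷ x₂ ∷ [])
  sum-leaf-x₁x₂x₃ = begin
    sum (λ y → sum (λ z → summand (x₁ ∷ x₂ ∷ x₃ ∷ y ∷ z ∷ [])))
      ≡⟨ sum-cong-≗ (λ y → sum-last-vertex x₁ x₂ x₃ y (+ 1 / 3) λ _ e → ψ-∷∷ x₁ x₂ (x₃ ∷ y ∷ e ∷ []) x₁∈O x₂∈O) ⟩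
    sum (λ y → when (isClique G (x₁ ∷ x₂ ∷ x₃ ∷ y ∷ [])) ((+ 1 / 3) * W G O))
      ≡⟨ sum-cong-≗ reweigh ⟩
    sumOn (λ y → allᵇ G (adj y) O) (λ _ → ((+ 1 / 3) * W G (x₁ ∷ x₂ ∷ [])) * inv G (cntK G 4 O))
      ≡⟨ sumOn-extensions-cancel G wd O cl (inj₂ (inj₁ refl)) ((+ 1 / 3) * W G (x₁ ∷ x₂ ∷ [])) ⟩
    (+ 1 / 3) * W G (x₁ ∷ x₂ ∷ [])
      ∎
    where
      open ≡-Reasoning
      reweigh : ∀ y → when (isClique G (x₁ ∷ x₂ ∷ x₃ ∷ y ∷ [])) ((+ 1 / 3) * W G O)
                    ≡ when (allᵇ G (adj y) O) (((+ 1 / 3) * W G (x₁ ∷ x₂ ∷ [])) * inv G (cntK G 4 O))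
      reweigh y = cong₂ when
        (trans (isClique-↭ G (shift y O [])) (trans (cong (allᵇ G (adj y) O ∧_) cl) (∧-identityʳ _)))
        (trans (cong ((+ 1 / 3) *_) (W-snoc₃ G x₁ x₂ x₃)) (sym (*-assoc (+ 1 / 3) (W G (x₁ ∷ x₂ ∷ [])) (inv G (cntK G 4 O)))))

  sum-leaf-R : ∀ (a b c d : V G → V G) (k : ℚ) (f : V G → ℚ) →
    (∀ y → a y ∷ b y ∷ c y ∷ d y ∷ [] ↭ y ∷ O) →
    (∀ y → inR′ y ≡ true → ∀ e → ψ G x₁ x₂ x₃ (a y ∷ b y ∷ c y ∷ d y ∷ e ∷ []) ≡ k) →
    (∀ y → W G (a y ∷ b y ∷ c y ∷ []) ≡ f y) →
    sum (λ y → sum (λ e → summand (a y ∷ b y ∷ c y ∷ d y ∷ e ∷ []))) ≡ k * sumOn inR′ f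
  sum-leaf-R a b c d k f perm ψ≡k W≡f =
    trans (sum-cong-≗ leaf) (sumOn-*ˡ inR′ k f)
    where
      isClique≡inR : ∀ y → isClique G (a y ∷ b y ∷ c y ∷ d y ∷ []) ≡ inR′ y
      isClique≡inR y = trans (isClique-↭ G (perm y)) (isClique-∷O y)
      leaf : ∀ y → sum (λ e → summand (a y ∷ b y ∷ c y ∷ d y ∷ e ∷ [])) ≡ when (inR′ y) (k * f y)
      leaf y = trans (sum-last-vertex (a y) (b y) (c y) (d y) k (ψ≡k y ∘ trans (sym (isClique≡inR y))))
                     (cong₂ when (isClique≡inR y) (cong (k *_) (W≡f y)))

  pairSum : (V G → V G → ℚ) → ℚ
  pairSum f = sumOn inR′ (λ y → sumOn (λ z → adj y z ∧ inR′ z) (f y))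

  sum-leaf-RR : ∀ (q : V G → V G → List (V G)) (k : ℚ) (f : V G → V G → ℚ) →
    (∀ y z → q y z ↭ y ∷ z ∷ O) →
    (∀ y z → inR′ y ≡ true → inR′ z ≡ true → ψ G x₁ x₂ x₃ (q y z) ≡ k) →
    (∀ y z → W G (take 4 (q y z)) ≡ f y z) →
    sum (λ y → sum (λ z → summand (q y z))) ≡ k * pairSum f
  sum-leaf-RR q k f perm ψ≡k W≡f = begin
    sum (λ y → sum (λ z → summand (q y z)))
      ≡⟨ sum-cong-≗ (λ y → trans (sum-cong-≗ (leaf y)) (sum-when (inR′ y) (λ z → when (adj y z ∧ inR′ z) (k * f y z)))) ⟩
    sumOn inR′ (λ y → sumOn (λ z → adj y z ∧ inR′ z) (λ z → k * f y z))
      ≡⟨ sumOn-cong inR′ (λ y _ → sumOn-*ˡ (λ z → adj y z ∧ inR′ z) k (f y)) ⟩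
    sumOn inR′ (λ y → k * sumOn (λ z → adj y z ∧ inR′ z) (f y))
      ≡⟨ sumOn-*ˡ inR′ k (λ y → sumOn (λ z → adj y z ∧ inR′ z) (f y)) ⟩
    k * pairSum f
      ∎
    where
      open ≡-Reasoning
      leaf : ∀ y z → summand (q y z) ≡ when (inR′ y) (when (adj y z ∧ inR′ z) (k * f y z))
      leaf y z = trans (cong (λ β → when β (W G (take 4 (q y z)) * ψ G x₁ x₂ x₃ (q y z)))
                             (trans (isClique-↭ G (perm y z)) (isClique-∷∷O y z)))
        (trans (when-cong (inR′ y ∧ (adj y z ∧ inR′ z)) value) (when-∧ (inR′ y) (adj y z ∧ inR′ z) (k * f y z)))
        where
          value : inR′ y ∧ (adj y z ∧ inR′ z) ≡ true → W G (take 4 (q y z)) * ψ G x₁ x₂ x₃ (q y z) ≡ k * f y z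
          value yz∈R with ∧-true⁻ (inR′ y) yz∈R
          ... | y∈R , rest with ∧-true⁻ (adj y z) rest
          ... | _ , z∈R = trans (cong₂ _*_ (W≡f y z) (ψ≡k y z y∈R z∈R)) (*-comm (f y z) k)

  ΣW-x₁yx₂ ΣW-x₁x₂y ΣΣW-x₁yx₂z ΣΣW-x₁x₂yz ΣΣW-x₁yzx₂ ΣΣW-zyx₁x₂ : ℚ
  ΣW-x₁yx₂   = sumOn inR′ (λ y → W G (x₁ ∷ y ∷ x₂ ∷ []))
  ΣW-x₁x₂y   = sumOn inR′ (λ y → W G (x₁ ∷ x₂ ∷ y ∷ []))
  ΣΣW-x₁yx₂z = pairSum (λ y z → W G (x₁ ∷ y ∷ x₂ ∷ z ∷ []))
  ΣΣW-x₁x₂yz = pairSum (λ y z → W G (x₁ ∷ x₂ ∷ y ∷ z ∷ []))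
  ΣΣW-x₁yzx₂ = pairSum (λ y z → W G (x₁ ∷ y ∷ z ∷ x₂ ∷ []))
  ΣΣW-zyx₁x₂ = pairSum (λ y z → W G (z ∷ y ∷ x₁ ∷ x₂ ∷ []))

  interleavedSum-expansion : interleavedSum G O 2 summand ≡
    ((+ 1 / 3) * W G (x₁ ∷ x₂ ∷ []) + ((+ 1 / 3) * ΣW-x₁x₂y + (+ 1 / 3) * ΣΣW-x₁x₂yz)
      + ((- (+ 1 / 6)) * ΣW-x₁yx₂ + (- (+ 1 / 6)) * ΣΣW-x₁yx₂z + (- (+ 1 / 6)) * ΣΣW-x₁yzx₂))
    + ((- (+ 1 / 6)) * ΣW-x₁yx₂ + (- (+ 1 / 6)) * ΣΣW-x₁yx₂z + (- (+ 1 / 6)) * ΣΣW-x₁yzx₂ + (+ 1 / 3) * ΣΣW-zyx₁x₂)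
  interleavedSum-expansion =
    cong₂ _+_ (cong₂ _+_ (cong₂ _+_ sum-leaf-x₁x₂x₃ (sum-+ {n} x₁x₂yx₃z x₁x₂yzx₃))
                         (sum-+ {n} (sum-+ {n} x₁yx₂x₃z x₁yx₂zx₃) x₁yzx₂x₃))
              (sum-+ {n} (sum-+ {n} (sum-+ {n} yx₁x₂x₃z yx₁x₂zx₃) yx₁zx₂x₃) yzx₁x₂x₃)
    where
      x₁x₂yx₃z = sum-leaf-R (λ _ → x₁) (λ _ → x₂) (λ y → y) (λ _ → x₃) (+ 1 / 3) _
        (λ y → shift y (x₁ ∷ x₂ ∷ []) (x₃ ∷ [])) (λ y _ e → ψ-∷∷ x₁ x₂ (y ∷ x₃ ∷ e ∷ []) x₁∈O x₂∈O) (λ _ → refl)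
      x₁yx₂x₃z = sum-leaf-R (λ _ → x₁) (λ y → y) (λ _ → x₂) (λ _ → x₃) (- (+ 1 / 6)) _
        (λ y → shift y (x₁ ∷ []) (x₂ ∷ x₃ ∷ [])) (λ y y∈R e → ψ-∷∷ x₁ y (x₂ ∷ x₃ ∷ e ∷ []) x₁∈O (R∌O y∈R)) (λ _ → refl)
      yx₁x₂x₃z = sum-leaf-R (λ y → y) (λ _ → x₁) (λ _ → x₂) (λ _ → x₃) (- (+ 1 / 6)) _
        (λ _ → ↭.refl) (λ y y∈R e → ψ-∷∷ y x₁ (x₂ ∷ x₃ ∷ e ∷ []) (R∌O y∈R) x₁∈O) (λ y → W-swap G y x₁ (x₂ ∷ []))
      x₁x₂yzx₃ = sum-leaf-RR (λ y z → x₁ ∷ x₂ ∷ y ∷ z ∷ x₃ ∷ []) (+ 1 / 3) _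
        (λ y z → ↭.trans (shift y (x₁ ∷ x₂ ∷ []) (z ∷ x₃ ∷ [])) (↭.prep y (shift z (x₁ ∷ x₂ ∷ []) (x₃ ∷ []))))
        (λ y z _ _ → ψ-∷∷ x₁ x₂ (y ∷ z ∷ x₃ ∷ []) x₁∈O x₂∈O) (λ _ _ → refl)
      x₁yx₂zx₃ = sum-leaf-RR (λ y z → x₁ ∷ y ∷ x₂ ∷ z ∷ x₃ ∷ []) (- (+ 1 / 6)) _
        (λ y z → ↭.trans (shift y (x₁ ∷ []) (x₂ ∷ z ∷ x₃ ∷ [])) (↭.prep y (shift z (x₁ ∷ x₂ ∷ []) (x₃ ∷ []))))
        (λ y z y∈R _ → ψ-∷∷ x₁ y (x₂ ∷ z ∷ x₃ ∷ []) x₁∈O (R∌O y∈R)) (λ _ _ → refl)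
      x₁yzx₂x₃ = sum-leaf-RR (λ y z → x₁ ∷ y ∷ z ∷ x₂ ∷ x₃ ∷ []) (- (+ 1 / 6)) _
        (λ y z → ↭.trans (shift y (x₁ ∷ []) (z ∷ x₂ ∷ x₃ ∷ [])) (↭.prep y (shift z (x₁ ∷ []) (x₂ ∷ x₃ ∷ []))))
        (λ y z y∈R _ → ψ-∷∷ x₁ y (z ∷ x₂ ∷ x₃ ∷ []) x₁∈O (R∌O y∈R)) (λ _ _ → refl)
      yx₁x₂zx₃ = sum-leaf-RR (λ y z → y ∷ x₁ ∷ x₂ ∷ z ∷ x₃ ∷ []) (- (+ 1 / 6)) _
        (λ y z → ↭.prep y (shift z (x₁ ∷ x₂ ∷ []) (x₃ ∷ [])))
        (λ y z y∈R _ → ψ-∷∷ y x₁ (x₂ ∷ z ∷ x₃ ∷ []) (R∌O y∈R) x₁∈O) (λ y z → W-swap G y x₁ (x₂ ∷ z ∷ []))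
      yx₁zx₂x₃ = sum-leaf-RR (λ y z → y ∷ x₁ ∷ z ∷ x₂ ∷ x₃ ∷ []) (- (+ 1 / 6)) _
        (λ y z → ↭.prep y (shift z (x₁ ∷ []) (x₂ ∷ x₃ ∷ [])))
        (λ y z y∈R _ → ψ-∷∷ y x₁ (z ∷ x₂ ∷ x₃ ∷ []) (R∌O y∈R) x₁∈O) (λ y z → W-swap G y x₁ (z ∷ x₂ ∷ []))
      yzx₁x₂x₃ = sum-leaf-RR (λ y z → y ∷ z ∷ x₁ ∷ x₂ ∷ x₃ ∷ []) (+ 1 / 3) _
        (λ _ _ → ↭.refl)
        (λ y z y∈R z∈R → ψ-∷∷ y z (x₁ ∷ x₂ ∷ x₃ ∷ []) (R∌O y∈R) (R∌O z∈R)) (λ y z → W-swap G y z (x₁ ∷ x₂ ∷ []))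

  rhs-expansion : rhs G x₁ x₂ x₃ ≡
    (+ 1 / 6) * (W G (x₁ ∷ x₂ ∷ []) - ((ΣW-x₁yx₂ - ΣW-x₁x₂y) + (((ΣΣW-x₁yx₂z - ΣΣW-x₁x₂yz) + ΣΣW-x₁yzx₂) - ΣΣW-zyx₁x₂)))
  rhs-expansion = cong (λ s → (+ 1 / 6) * (W G (x₁ ∷ x₂ ∷ []) - s)) (begin
    sumMap (λ y → (W G (x₁ ∷ y ∷ x₂ ∷ []) - W G (x₁ ∷ x₂ ∷ y ∷ [])) + inner y) (R G x₁ x₂ x₃)
      ≡⟨ sumMap-filterᵇ-allFin inR′ _ ⟩
    sumOn inR′ (λ y → (W G (x₁ ∷ y ∷ x₂ ∷ []) - W G (x₁ ∷ x₂ ∷ y ∷ [])) + inner y)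
      ≡⟨ sumOn-+ inR′ _ inner ⟩
    sumOn inR′ (λ y → W G (x₁ ∷ y ∷ x₂ ∷ []) - W G (x₁ ∷ x₂ ∷ y ∷ [])) + sumOn inR′ inner
      ≡⟨ cong₂ _+_ (sumOn-- inR′ _ _) (trans (sumOn-cong inR′ (λ y _ → inner-expansion y)) (sumOn-combination inR′ _ _ _ _)) ⟩
    (ΣW-x₁yx₂ - ΣW-x₁x₂y) + (((ΣΣW-x₁yx₂z - ΣΣW-x₁x₂yz) + ΣΣW-x₁yzx₂) - ΣΣW-zyx₁x₂)
      ∎)
    where
      open ≡-Reasoning
      N : V G → V G → Bool
      N y z = adj y z ∧ inR′ z
      inner : V G → ℚ
      inner y = sumMap (λ z → ((W G (x₁ ∷ y ∷ x₂ ∷ z ∷ []) - W G (x₁ ∷ x₂ ∷ y ∷ z ∷ [])) + W G (x₁ ∷ y ∷ z ∷ x₂ ∷ []))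
                              - W G (z ∷ y ∷ x₁ ∷ x₂ ∷ [])) (NR G x₁ x₂ x₃ y)
      inner-expansion : ∀ y → inner y ≡
        ((sumOn (N y) (λ z → W G (x₁ ∷ y ∷ x₂ ∷ z ∷ [])) - sumOn (N y) (λ z → W G (x₁ ∷ x₂ ∷ y ∷ z ∷ [])))
          + sumOn (N y) (λ z → W G (x₁ ∷ y ∷ z ∷ x₂ ∷ []))) - sumOn (N y) (λ z → W G (z ∷ y ∷ x₁ ∷ x₂ ∷ []))
      inner-expansion y = trans (sumMap-filterᵇ-allFin (N y) _) (sumOn-combination (N y) _ _ _ _)

ℚ-ring : AlmostCommutativeRing _ _
ℚ-ring = fromCommutativeRing +-*-commutativeRing λ x → dec⇒maybe (0ℚ ℚ.≟ x)

collect-coefficients : ∀ (w a b c d e f : ℚ) →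
  (+ 1 / 2) * (((+ 1 / 3) * w + ((+ 1 / 3) * b + (+ 1 / 3) * d) + ((- (+ 1 / 6)) * a + (- (+ 1 / 6)) * c + (- (+ 1 / 6)) * e))
               + ((- (+ 1 / 6)) * a + (- (+ 1 / 6)) * c + (- (+ 1 / 6)) * e + (+ 1 / 3) * f))
    ≡ (+ 1 / 6) * (w - ((a - b) + (((c - d) + e) - f)))
collect-coefficients = solve-∀ ℚ-ring

lemma3p15 : (G : Graph) → WellDefined G →
    (x₁ x₂ x₃ : V G) → isClique G (x₁ ∷ x₂ ∷ x₃ ∷ []) ≡ true →
    w G x₁ x₂ x₃ ≡ rhs G x₁ x₂ x₃
lemma3p15 G wd x₁ x₂ x₃ cl =
  trans w≡½interleavedSum
    (trans (cong ((+ 1 / 2) *_) interleavedSum-expansion)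
      (trans (collect-coefficients (W G (x₁ ∷ x₂ ∷ [])) ΣW-x₁yx₂ ΣW-x₁x₂y ΣΣW-x₁yx₂z ΣΣW-x₁x₂yz ΣΣW-x₁yzx₂ ΣΣW-zyx₁x₂)
        (sym rhs-expansion)))
  where open Lemma3-15 G wd x₁ x₂ x₃ cl
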